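{- Let $R$ be a set of rewrite rules on $\mathbf{Mag}$, i.e. of pairs $(\mathfrak{t},\mathfrak{t}')$ of binary trees with the same number of leaves. If $\mathrm{p}(\mathfrak{t})>\mathrm{p}(\mathfrak{t}')$ in the lexicographic order for every $(\mathfrak{t},\mathfrak{t}')\in R$, then the rewrite relation induced by $R$ is terminating.
   Context: A binary tree is either the leaf or an ordered pair $(\mathfrak{t}_1,\mathfrak{t}_2)$ of binary trees. Its prefix word is the word over $\{0,2\}$ given by $\mathrm{p}(\text{leaf})=0$ and $\mathrm{p}((\mathfrak{t}_1,\mathfrak{t}_2))=2\,\mathrm{p}(\mathfrak{t}_1)\,\mathrm{p}(\mathfrak{t}_2)$; words are compared lexicographically with $0<2$ (trees with the same number of leaves have prefix words of the same length). $\mathbf{Mag}$ is the nonsymmetric set-theoretic operad of binary trees, with $\mathfrak{t}\circ_i\mathfrak{s}$ grafting the root of $\mathfrak{s}$ onto the $i$-th leaf of $\mathfrak{t}$, and $\mathfrak{s}\circ[\mathfrak{r}_1,\dots,\mathfrak{r}_n]$ grafting simultaneously each $\mathfrak{r}_j$ onto the $j$-th leaf of $\mathfrak{s}$. The rewrite relation induced by $R$ is $\mathfrak{t}\circ_i(\mathfrak{s}\circ[\mathfrak{r}_1,\dots,\mathfrak{r}_n])\to\mathfrak{t}\circ_i(\mathfrak{s}'\circ[\mathfrak{r}_1,\dots,\mathfrak{r}_n])$ for all $(\mathfrak{s},\mathfrak{s}')\in R$, all trees $\mathfrak{t},\mathfrak{r}_1,\dots,\mathfrak{r}_n$ ($n$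 the number of leaves of $\mathfrak{s}$) and valid $i$. It is terminating if there is no infinite chain $\mathfrak{t}_0\to\mathfrak{t}_1\to\mathfrak{t}_2\to\cdots$. -}

module Defs where

open import Data.Nat using (ℕ; zero; suc; _+_)
open import Data.Fin using (Fin; zero; suc)
open import Data.List using (List; []; _∷_; _++_; length)
open import Data.Product using (Σ; _×_; _,_; ∃)
open import Data.Maybe using (Maybe; just; nothing)
open import Relation.Binary.PropositionalEquality using (_≡_)
open import Relation.Nullary using (¬_)
import Data.List.Relation.Binary.Lex.Strict as LexS

data Tree : Set where
  leaf : Tree
  node : Tree → Tree → Tree

leaves : Tree → ℕ
leaves leaf = 1
leaves (node t₁ t₂) = leaves t₁ + leaves t₂

data Letter : Set where
  l0 l2 : Letter

data _<L_ : Letter → Letter → Set where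
  0<2 : l0 <L l2

p : Tree → List Letter
p leaf = l0 ∷ []
p (node t₁ t₂) = l2 ∷ (p t₁ ++ p t₂)

-- strict lexicographic order on words (proper prefixes are smaller;
-- irrelevant here since compared words have equal length)
_<lex_ : List Letter → List Letter → Set
_<lex_ = LexS.Lex-< _≡_ _<L_

-- partial grafting t ∘ᵢ s : graft s onto the i-th leaf of t (leaves numbered
-- left to right from 0). Returns the tree together with leftover index.
-- Defined via an index into ℕ; for i : Fin (leaves t) it always succeeds.
graftAt : Tree → ℕ → Tree → Tree × Maybe ℕ
graftAt leaf zero s = s , nothing
graftAt leaf (suc i) s = leaf , just i
graftAt (node t₁ t₂) i s with graftAt t₁ i s
... | t₁' , nothing = node t₁' t₂ , nothing
... | t₁' , just j with graftAt t₂ j s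
...   | t₂' , r = node t₁' t₂' , r

_∘⟨_⟩_ : (t : Tree) → Fin (leaves t) → Tree → Tree
t ∘⟨ i ⟩ s = Data.Product.proj₁ (graftAt t (Data.Fin.toℕ i) s)

-- simultaneous grafting s ∘ [r₁,…,rₙ], consuming trees left to right;
-- returns the result and the unused trees.
graftAll : Tree → List Tree → Tree × List Tree
graftAll leaf [] = leaf , []
graftAll leaf (r ∷ rs) = r , rs
graftAll (node s₁ s₂) rs with graftAll s₁ rs
... | s₁' , rs' with graftAll s₂ rs'
...   | s₂' , rs'' = node s₁' s₂' , rs''

_∘[_] : Tree → List Tree → Tree
s ∘[ rs ] = Data.Product.proj₁ (graftAll s rs)

data Step (R : Tree → Tree → Set) : Tree → Tree → Set where
  step : (t s s' : Tree) (rs : List Tree) (i : Fin (leaves t)) →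
         R s s' → length rs ≡ leaves s →
         Step R (t ∘⟨ i ⟩ (s ∘[ rs ])) (t ∘⟨ i ⟩ (s' ∘[ rs ]))

Terminating : (Tree → Tree → Set) → Set
Terminating _⟶_ = ¬ (Σ (ℕ → Tree) λ f → ∀ n → f n ⟶ f (suc n))

-- Read a word over {0,2} of fixed length as a binary numeral, with 2 as the digit 1: the
-- lexicographic order on words of equal length then becomes the order on ℕ.  A rewrite step
-- replaces the factor p(s ∘ [r₁,…,rₙ]) of a prefix word by p(s' ∘ [r₁,…,rₙ]), and both are
-- obtained from p s and p s' by substituting p rⱼ for the j-th letter 0.  This substitution is
-- strictly monotone for the lexicographic order, and the lengths agree since s and s' have the
-- same number of leaves; so every step strictly decreases a natural number.
module Submission where

open import Defs
open import Data.Product using (_×_)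
open import Relation.Binary.PropositionalEquality using (_≡_)

open import Data.Nat using (ℕ; zero; suc; _+_; _∸_; _^_; _≤_; _<_; z≤n; s≤s)
open import Data.Nat.Properties
open import Data.Nat.Induction using (<-wellFounded)
open import Data.Fin using (toℕ)
open import Data.Fin.Properties using (toℕ<n)
open import Data.List using (List; []; _∷_; _++_; length; replicate; map)
open import Data.Nat.ListAction using (sum)
open import Data.List.Properties using (length-++; ++-assoc; ++-identityʳ)
open import Data.List.Relation.Binary.Lex.Strict using (base; halt; this; next)
open import Data.Product using (∃; ∃₂; _,_; proj₁; proj₂)
open import Data.Maybe using (just; nothing)
open import Data.Empty using (⊥)
open import Function using (_∘_)
open import Induction.WellFounded using (WellFounded; Acc; acc)
open import Induction.InfiniteDescent using (InfiniteDescendingSequence)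
open import Relation.Binary.Core using (Rel)
open import Relation.Nullary using (¬_; yes; no)
open import Relation.Binary.PropositionalEquality
  using (refl; sym; trans; cong; cong₂; subst; subst₂; module ≡-Reasoning)

open ≡-Reasoning

wellFounded⇒¬infiniteDescent : ∀ {a r} {A : Set a} {_≺_ : Rel A r} → WellFounded _≺_ →
                               ∀ f → ¬ InfiniteDescendingSequence _≺_ f
wellFounded⇒¬infiniteDescent {_≺_ = _≺_} wf f descends = inaccessible 0 (wf (f 0))
  where
  inaccessible : ∀ n → Acc _≺_ (f n) → ⊥
  inaccessible n (acc rs) = inaccessible (suc n) (rs (descends n))

<lex-++ˡ : ∀ w {u v} → u <lex v → (w ++ u) <lex (w ++ v)
<lex-++ˡ []      u<v = u<v
<lex-++ˡ (_ ∷ w) u<v = next refl (<lex-++ˡ w u<v)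

<lex-++ʳ : ∀ {u v} a b → length u ≡ length v → u <lex v → (u ++ a) <lex (v ++ b)
<lex-++ʳ a b () halt
<lex-++ʳ a b _  (this x<y) = this x<y
<lex-++ʳ a b eq (next refl u<v) = next refl (<lex-++ʳ a b (suc-injective eq) u<v)

_⊏_ : List Letter → List Letter → Set
u ⊏ v = length u ≡ length v × u <lex v

⊏-context : ∀ pre post {u v} → u ⊏ v → (pre ++ u ++ post) ⊏ (pre ++ v ++ post)
⊏-context pre post {u} {v} (eq , u<v) = length-eq , <lex-++ˡ pre (<lex-++ʳ post post eq u<v)
  where
  length-eq : length (pre ++ u ++ post) ≡ length (pre ++ v ++ post)
  length-eq = begin
    length (pre ++ u ++ post)                ≡⟨ length-++ pre ⟩
    length pre + length (u ++ post)          ≡⟨ cong (length pre +_) (length-++ u) ⟩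
    length pre + (length u + length post)    ≡⟨ cong (λ n → length pre + (n + length post)) eq ⟩
    length pre + (length v + length post)    ≡⟨ cong (length pre +_) (length-++ v) ⟨
    length pre + length (v ++ post)          ≡⟨ length-++ pre ⟨
    length (pre ++ v ++ post)                ∎

binary : List Letter → ℕ
binary []       = 0
binary (l0 ∷ w) = binary w
binary (l2 ∷ w) = 2 ^ length w + binary w

binary<2^length : ∀ w → binary w < 2 ^ length w
binary<2^length []       = s≤s z≤n
binary<2^length (l0 ∷ w) = ≤-trans (binary<2^length w) (m≤m+n (2 ^ length w) _)
binary<2^length (l2 ∷ w) = subst₂ _<_ refl (cong (2 ^ length w +_) (sym (+-identityʳ _)))
                                 (+-monoʳ-< (2 ^ length w) (binary<2^length w))

⊏⇒binary< : ∀ {u v} → u ⊏ v → binary u < binary v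
⊏⇒binary< (() , halt)
⊏⇒binary< {_ ∷ u} {_ ∷ v} (eq , this 0<2) =
  ≤-trans (binary<2^length u)
          (≤-trans (≤-reflexive (cong (2 ^_) (suc-injective eq))) (m≤m+n (2 ^ length v) _))
⊏⇒binary< {l0 ∷ _} (eq , next refl u<v) = ⊏⇒binary< (suc-injective eq , u<v)
⊏⇒binary< {l2 ∷ _} {_ ∷ v} (eq , next refl u<v) rewrite suc-injective eq =
  +-monoʳ-< (2 ^ length v) (⊏⇒binary< (suc-injective eq , u<v))

count0 count2 : List Letter → ℕ
count0 []       = 0
count0 (l0 ∷ w) = suc (count0 w)
count0 (l2 ∷ w) = count0 w
count2 []       = 0
count2 (l0 ∷ w) = count2 w
count2 (l2 ∷ w) = suc (count2 w)

count0-++ : ∀ u v → count0 (u ++ v) ≡ count0 u + count0 v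
count0-++ []       v = refl
count0-++ (l0 ∷ u) v = cong suc (count0-++ u v)
count0-++ (l2 ∷ u) v = count0-++ u v

count2-++ : ∀ u v → count2 (u ++ v) ≡ count2 u + count2 v
count2-++ []       v = refl
count2-++ (l0 ∷ u) v = count2-++ u v
count2-++ (l2 ∷ u) v = cong suc (count2-++ u v)

count0-p : ∀ t → count0 (p t) ≡ leaves t
count0-p leaf         = refl
count0-p (node t₁ t₂) = trans (count0-++ (p t₁) (p t₂)) (cong₂ _+_ (count0-p t₁) (count0-p t₂))

suc-count2-p : ∀ t → suc (count2 (p t)) ≡ leaves t
suc-count2-p leaf         = refl
suc-count2-p (node t₁ t₂) = begin
  suc (suc (count2 (p t₁ ++ p t₂)))        ≡⟨ cong (suc ∘ suc) (count2-++ (p t₁) (p t₂)) ⟩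
  suc (suc (count2 (p t₁) + count2 (p t₂))) ≡⟨ cong suc (+-suc (count2 (p t₁)) _) ⟨
  suc (count2 (p t₁)) + suc (count2 (p t₂)) ≡⟨ cong₂ _+_ (suc-count2-p t₁) (suc-count2-p t₂) ⟩
  leaves t₁ + leaves t₂                     ∎

-- Once the trees run out, the remaining letters 0 are kept, just as graftAll leaves such
-- leaves in place.
substitute : List Letter → List Tree → List Letter
substitute []       rs       = []
substitute (l0 ∷ w) []       = l0 ∷ substitute w []
substitute (l0 ∷ w) (r ∷ rs) = p r ++ substitute w rs
substitute (l2 ∷ w) rs       = l2 ∷ substitute w rs

substitute-p++ : ∀ s rs w → substitute (p s ++ w) rs
                            ≡ p (proj₁ (graftAll s rs)) ++ substitute w (proj₂ (graftAll s rs))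
substitute-p++ leaf []       w = refl
substitute-p++ leaf (r ∷ rs) w = refl
substitute-p++ (node s₁ s₂) rs w
  rewrite ++-assoc (p s₁) (p s₂) w
  with graftAll s₁ rs | substitute-p++ s₁ rs (p s₂ ++ w)
... | s₁' , rs' | eq₁ with graftAll s₂ rs' | substitute-p++ s₂ rs' w
...   | s₂' , rs'' | eq₂ = cong (l2 ∷_) (begin
  substitute (p s₁ ++ p s₂ ++ w) rs        ≡⟨ eq₁ ⟩
  p s₁' ++ substitute (p s₂ ++ w) rs'      ≡⟨ cong (p s₁' ++_) eq₂ ⟩
  p s₁' ++ p s₂' ++ substitute w rs''      ≡⟨ ++-assoc (p s₁') (p s₂') _ ⟨
  (p s₁' ++ p s₂') ++ substitute w rs''    ∎)

p-∘[] : ∀ s rs → p (s ∘[ rs ]) ≡ substitute (p s) rs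
p-∘[] s rs = begin
  p (s ∘[ rs ])                  ≡⟨ ++-identityʳ _ ⟨
  p (s ∘[ rs ]) ++ []            ≡⟨ substitute-p++ s rs [] ⟨
  substitute (p s ++ []) rs      ≡⟨ cong (λ w → substitute w rs) (++-identityʳ (p s)) ⟩
  substitute (p s) rs            ∎

length-substitute : ∀ w rs → count0 w ≡ length rs →
                    length (substitute w rs) ≡ sum (map (length ∘ p) rs) + count2 w
length-substitute []       []       _  = refl
length-substitute (l0 ∷ w) (r ∷ rs) eq = begin
  length (p r ++ substitute w rs)                          ≡⟨ length-++ (p r) ⟩
  length (p r) + length (substitute w rs)
    ≡⟨ cong (length (p r) +_) (length-substitute w rs (suc-injective eq)) ⟩
  length (p r) + (sum (map (length ∘ p) rs) + count2 w)    ≡⟨ +-assoc (length (p r)) _ _ ⟨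
  sum (map (length ∘ p) (r ∷ rs)) + count2 w               ∎
length-substitute (l2 ∷ w) rs eq =
  trans (cong suc (length-substitute w rs eq)) (sym (+-suc _ (count2 w)))

data EndsWith0 : List Letter → Set where
  [l0] : EndsWith0 (l0 ∷ [])
  _∷_  : ∀ x {w} → EndsWith0 w → EndsWith0 (x ∷ w)

EndsWith0-++ˡ : ∀ u {v} → EndsWith0 v → EndsWith0 (u ++ v)
EndsWith0-++ˡ []      e = e
EndsWith0-++ˡ (x ∷ u) e = x ∷ EndsWith0-++ˡ u e

EndsWith0-p : ∀ t → EndsWith0 (p t)
EndsWith0-p leaf         = [l0]
EndsWith0-p (node t₁ t₂) = l2 ∷ EndsWith0-++ˡ (p t₁) (EndsWith0-p t₂)

EndsWith0⇒first0 : ∀ {w} → EndsWith0 w → ∃₂ λ k z → w ≡ replicate k l2 ++ l0 ∷ z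
EndsWith0⇒first0 [l0]     = 0 , [] , refl
EndsWith0⇒first0 (l0 ∷ _) = 0 , _ , refl
EndsWith0⇒first0 (l2 ∷ e) with EndsWith0⇒first0 e
... | k , z , refl = suc k , z , refl

substitute-first0 : ∀ k z r rs → substitute (replicate k l2 ++ l0 ∷ z) (r ∷ rs)
                                  ≡ replicate k l2 ++ p r ++ substitute z rs
substitute-first0 zero    z r rs = refl
substitute-first0 (suc k) z r rs = cong (l2 ∷_) (substitute-first0 k z r rs)

replicate-++-∷ : ∀ {A : Set} k (x : A) w → replicate k x ++ x ∷ w ≡ x ∷ replicate k x ++ w
replicate-++-∷ zero    x w = refl
replicate-++-∷ (suc k) x w = cong (x ∷_) (replicate-++-∷ k x w)

-- Along the leftmost branch of r, the left side reaches the 0 of a leaf while the right side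
-- is still inside its leading run of 2s.
p-<lex-twos-p : ∀ r k X Y → (p r ++ X) <lex (l2 ∷ replicate k l2 ++ p r ++ Y)
p-<lex-twos-p leaf         k X Y = this 0<2
p-<lex-twos-p (node r₁ r₂) k X Y = next refl (subst₂ _<lex_ left-eq right-eq
                                     (p-<lex-twos-p r₁ k (p r₂ ++ X) (p r₂ ++ Y)))
  where
  left-eq : p r₁ ++ p r₂ ++ X ≡ (p r₁ ++ p r₂) ++ X
  left-eq = sym (++-assoc (p r₁) (p r₂) X)
  right-eq : l2 ∷ replicate k l2 ++ p r₁ ++ p r₂ ++ Y ≡ replicate k l2 ++ (l2 ∷ p r₁ ++ p r₂) ++ Y
  right-eq = begin
    l2 ∷ replicate k l2 ++ p r₁ ++ p r₂ ++ Y
      ≡⟨ cong (λ w → l2 ∷ replicate k l2 ++ w) (++-assoc (p r₁) (p r₂) Y) ⟨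
    l2 ∷ replicate k l2 ++ (p r₁ ++ p r₂) ++ Y
      ≡⟨ replicate-++-∷ k l2 _ ⟨
    replicate k l2 ++ (l2 ∷ p r₁ ++ p r₂) ++ Y
      ∎

substitute-<lex : ∀ {w' w} rs → w' <lex w → EndsWith0 w → substitute w' rs <lex substitute w rs
substitute-<lex {w = l2 ∷ _} rs             halt _ = halt
substitute-<lex {w = l0 ∷ _} []             halt _ = halt
substitute-<lex {w = l0 ∷ _} (leaf ∷ _)     halt _ = halt
substitute-<lex {w = l0 ∷ _} (node _ _ ∷ _) halt _ = halt
substitute-<lex []       (this 0<2) _ = this 0<2
substitute-<lex (r ∷ rs) (this {xs = w'} 0<2) (_ ∷ e) with EndsWith0⇒first0 e
... | k , z , refl rewrite substitute-first0 k z r rs =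
  p-<lex-twos-p r k (substitute w' rs) (substitute z rs)
substitute-<lex rs       (next {x = l2} refl w'<w) (_ ∷ e) = next refl (substitute-<lex rs w'<w e)
substitute-<lex []       (next {x = l0} refl w'<w) (_ ∷ e) = next refl (substitute-<lex [] w'<w e)
substitute-<lex (r ∷ rs) (next {x = l0} refl w'<w) (_ ∷ e) =
  <lex-++ˡ (p r) (substitute-<lex rs w'<w e)
substitute-<lex rs       (next {x = l0} refl (base ())) [l0]

∘[]-⊏ : ∀ {s s'} → leaves s ≡ leaves s' → p s' <lex p s →
        ∀ rs → length rs ≡ leaves s → p (s' ∘[ rs ]) ⊏ p (s ∘[ rs ])
∘[]-⊏ {s} {s'} same-leaves p-s'<p-s rs rs-fits =
  subst₂ _⊏_ (sym (p-∘[] s' rs)) (sym (p-∘[] s rs))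
    (length-eq , substitute-<lex rs p-s'<p-s (EndsWith0-p s))
  where
  same-count2 : count2 (p s') ≡ count2 (p s)
  same-count2 =
    suc-injective (trans (suc-count2-p s') (trans (sym same-leaves) (sym (suc-count2-p s))))

  length-eq : length (substitute (p s') rs) ≡ length (substitute (p s) rs)
  length-eq = begin
    length (substitute (p s') rs)
      ≡⟨ length-substitute (p s') rs (trans (count0-p s') (sym (trans rs-fits same-leaves))) ⟩
    _ + count2 (p s')
      ≡⟨ cong (_ +_) same-count2 ⟩
    _ + count2 (p s)
      ≡⟨ length-substitute (p s) rs (trans (count0-p s) (sym rs-fits)) ⟨
    length (substitute (p s) rs)
      ∎

graftAt-past : ∀ t i → leaves t ≤ i → ∀ s → graftAt t i s ≡ (t , just (i ∸ leaves t))
graftAt-past leaf (suc i) _ s = refl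
graftAt-past (node t₁ t₂) i t≤i s
  rewrite graftAt-past t₁ i (≤-trans (m≤m+n (leaves t₁) (leaves t₂)) t≤i) s
        | graftAt-past t₂ (i ∸ leaves t₁)
            (subst₂ _≤_ (m+n∸m≡n (leaves t₁) (leaves t₂)) refl (∸-monoˡ-≤ (leaves t₁) t≤i)) s
        | ∸-+-assoc i (leaves t₁) (leaves t₂) = refl

GraftsTo : Tree → ℕ → Tree → List Letter → Set
GraftsTo t i s w = ∃ λ a → graftAt t i s ≡ (a , nothing) × p a ≡ w

graftsTo-node-left : ∀ {i s w} t₁ t₂ → GraftsTo t₁ i s w →
                     GraftsTo (node t₁ t₂) i s (l2 ∷ w ++ p t₂)
graftsTo-node-left t₁ t₂ (a , graft-eq , p-eq) rewrite graft-eq =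
  node a t₂ , refl , cong (λ w → l2 ∷ w ++ p t₂) p-eq

graftsTo-node-right : ∀ {i s w} t₁ t₂ → leaves t₁ ≤ i → GraftsTo t₂ (i ∸ leaves t₁) s w →
                      GraftsTo (node t₁ t₂) i s (l2 ∷ p t₁ ++ w)
graftsTo-node-right {i} {s} t₁ t₂ t₁≤i (a , graft-eq , p-eq)
  rewrite graftAt-past t₁ i t₁≤i s | graft-eq =
  node t₁ a , refl , cong (λ w → l2 ∷ p t₁ ++ w) p-eq

graftAt-context : ∀ t i → i < leaves t →
                  ∃₂ λ pre post → ∀ s → GraftsTo t i s (pre ++ p s ++ post)
graftAt-context leaf zero _ = [] , [] , λ s → s , refl , sym (++-identityʳ (p s))
graftAt-context leaf (suc i) (s≤s ())
graftAt-context (node t₁ t₂) i i<t with i <? leaves t₁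
... | yes i<t₁ =
  let pre , post , hole = graftAt-context t₁ i i<t₁ in
  l2 ∷ pre , post ++ p t₂ , λ s → subst (GraftsTo (node t₁ t₂) i s) (reassociate pre s post)
                                        (graftsTo-node-left t₁ t₂ (hole s))
  where
  reassociate : ∀ pre s post → l2 ∷ (pre ++ p s ++ post) ++ p t₂ ≡ l2 ∷ pre ++ p s ++ post ++ p t₂
  reassociate pre s post =
    cong (l2 ∷_) (trans (++-assoc pre _ (p t₂)) (cong (pre ++_) (++-assoc (p s) post (p t₂))))
... | no i≮t₁ =
  let pre , post , hole = graftAt-context t₂ (i ∸ leaves t₁) i∸t₁<t₂ in
  l2 ∷ p t₁ ++ pre , post , λ s → subst (GraftsTo (node t₁ t₂) i s)
                                          (cong (l2 ∷_) (sym (++-assoc (p t₁) pre _)))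
                                          (graftsTo-node-right t₁ t₂ (≮⇒≥ i≮t₁) (hole s))
  where
  i∸t₁<t₂ : i ∸ leaves t₁ < leaves t₂
  i∸t₁<t₂ = subst₂ _<_ refl (m+n∸m≡n (leaves t₁) (leaves t₂)) (∸-monoˡ-< i<t (≮⇒≥ i≮t₁))

p-∘⟨⟩ : ∀ t i → ∃₂ λ pre post → ∀ s → p (t ∘⟨ i ⟩ s) ≡ pre ++ p s ++ post
p-∘⟨⟩ t i =
  let pre , post , hole = graftAt-context t (toℕ i) (toℕ<n i) in
  pre , post , λ s → let _ , graft-eq , p-eq = hole s in trans (cong (p ∘ proj₁) graft-eq) p-eq

step-⊏ : ∀ {R} → (∀ {s s'} → R s s' → leaves s ≡ leaves s') →
         (∀ {s s'} → R s s' → p s' <lex p s) → ∀ {a b} → Step R a b → p b ⊏ p a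
step-⊏ same-leaves p-decreases (step t s s' rs i rule rs-fits) =
  let pre , post , p-eq = p-∘⟨⟩ t i in
  subst₂ _⊏_ (sym (p-eq _)) (sym (p-eq _))
    (⊏-context pre post (∘[]-⊏ (same-leaves rule) (p-decreases rule) rs rs-fits))

lemma1p3p1 : (R : Tree → Tree → Set) →
    (∀ {s s'} → R s s' → leaves s ≡ leaves s') →
    (∀ {s s'} → R s s' → p s' <lex p s) →
    Terminating (Step R)
lemma1p3p1 _ same-leaves p-decreases (f , chain) =
  wellFounded⇒¬infiniteDescent <-wellFounded (binary ∘ p ∘ f)
    (λ n → ⊏⇒binary< (step-⊏ same-leaves p-decreases (chain n)))
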